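{- Let $\Lambda_{24}(1)\subset\mathbb{R}^{24}$ be the set of the 196560 minimal vectors of the Leech lattice. There exists a subset $H\subset\Lambda_{24}(1)$ containing exactly one vector from each antipodal pair $\{v,-v\}$ such that $\sum_{v\in H}v=\mathbf{0}$.
   Context: In the standard coordinates (scaled by $\sqrt8$), $\Lambda_{24}(1)$ consists of: (a) the 1104 vectors of shape $(\pm4,\pm4,0^{22})$ (all positions and signs); (b) the 97152 vectors of shape $(\pm2^8,0^{16})$ whose support is an octad (weight-8 codeword) of the extended binary Golay code $\mathscr{C}$ and with an even number of minus signs; (c) the 98304 vectors of shape $(\mp3,\pm1^{23})$ obtained as follows: take a vector with one coordinate $-3$ and all others $1$, and change signs exactly on the positions of the $1$'s of a codeword of $\mathscr{C}$. -}

module Defs where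

open import Data.Bool using (Bool; true; false; if_then_else_; _xor_)
open import Data.Nat using (ℕ)
open import Data.Nat.Divisibility using (_∣_)
open import Data.Fin using (Fin; _≟_)
open import Data.Integer using (ℤ; +_; -_; _+_)
open import Data.Vec using (Vec; []; _∷_; zipWith; replicate; lookup; tabulate; map; countᵇ; _[_]≔_)
open import Data.List using (List; foldr)
open import Data.Product using (Σ; ∃; ∃₂; _×_)
open import Data.Sum using (_⊎_)
open import Relation.Binary.PropositionalEquality using (_≡_; _≢_)
open import Relation.Nullary.Decidable using (⌊_⌋)

-- We take the concrete model:
-- the cyclic [23,12,7] quadratic-residue (Golay) code generated by
-- g(x) = 1 + x² + x⁴ + x⁵ + x⁶ + x¹⁰ + x¹¹, extended by an overall
-- parity bit.  Generator rows: the 12 shifts x^s g(x) (s = 0..11),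
-- each followed by its parity bit.  (Weight enumerator checked:
-- 1 + 759 y⁸ + 2576 y¹² + 759 y¹⁶ + y²⁴.)

Word : Set
Word = Vec Bool 24

private
  I O : Bool
  I = true
  O = false

_⊕_ : {n : ℕ} → Vec Bool n → Vec Bool n → Vec Bool n
_⊕_ = zipWith _xor_

zeroWord : Word
zeroWord = replicate 24 false

golayGen : Vec Word 12
golayGen =
    (I ∷ O ∷ I ∷ O ∷ I ∷ I ∷ I ∷ O ∷ O ∷ O ∷ I ∷ I ∷ O ∷ O ∷ O ∷ O ∷ O ∷ O ∷ O ∷ O ∷ O ∷ O ∷ O ∷ I ∷ [])
  ∷     (O ∷ I ∷ O ∷ I ∷ O ∷ I ∷ I ∷ I ∷ O ∷ O ∷ O ∷ I ∷ I ∷ O ∷ O ∷ O ∷ O ∷ O ∷ O ∷ O ∷ O ∷ O ∷ O ∷ I ∷ [])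
  ∷     (O ∷ O ∷ I ∷ O ∷ I ∷ O ∷ I ∷ I ∷ I ∷ O ∷ O ∷ O ∷ I ∷ I ∷ O ∷ O ∷ O ∷ O ∷ O ∷ O ∷ O ∷ O ∷ O ∷ I ∷ [])
  ∷     (O ∷ O ∷ O ∷ I ∷ O ∷ I ∷ O ∷ I ∷ I ∷ I ∷ O ∷ O ∷ O ∷ I ∷ I ∷ O ∷ O ∷ O ∷ O ∷ O ∷ O ∷ O ∷ O ∷ I ∷ [])
  ∷     (O ∷ O ∷ O ∷ O ∷ I ∷ O ∷ I ∷ O ∷ I ∷ I ∷ I ∷ O ∷ O ∷ O ∷ I ∷ I ∷ O ∷ O ∷ O ∷ O ∷ O ∷ O ∷ O ∷ I ∷ [])
  ∷     (O ∷ O ∷ O ∷ O ∷ O ∷ I ∷ O ∷ I ∷ O ∷ I ∷ I ∷ I ∷ O ∷ O ∷ O ∷ I ∷ I ∷ O ∷ O ∷ O ∷ O ∷ O ∷ O ∷ I ∷ [])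
  ∷     (O ∷ O ∷ O ∷ O ∷ O ∷ O ∷ I ∷ O ∷ I ∷ O ∷ I ∷ I ∷ I ∷ O ∷ O ∷ O ∷ I ∷ I ∷ O ∷ O ∷ O ∷ O ∷ O ∷ I ∷ [])
  ∷     (O ∷ O ∷ O ∷ O ∷ O ∷ O ∷ O ∷ I ∷ O ∷ I ∷ O ∷ I ∷ I ∷ I ∷ O ∷ O ∷ O ∷ I ∷ I ∷ O ∷ O ∷ O ∷ O ∷ I ∷ [])
  ∷     (O ∷ O ∷ O ∷ O ∷ O ∷ O ∷ O ∷ O ∷ I ∷ O ∷ I ∷ O ∷ I ∷ I ∷ I ∷ O ∷ O ∷ O ∷ I ∷ I ∷ O ∷ O ∷ O ∷ I ∷ [])
  ∷     (O ∷ O ∷ O ∷ O ∷ O ∷ O ∷ O ∷ O ∷ O ∷ I ∷ O ∷ I ∷ O ∷ I ∷ I ∷ I ∷ O ∷ O ∷ O ∷ I ∷ I ∷ O ∷ O ∷ I ∷ [])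
  ∷     (O ∷ O ∷ O ∷ O ∷ O ∷ O ∷ O ∷ O ∷ O ∷ O ∷ I ∷ O ∷ I ∷ O ∷ I ∷ I ∷ I ∷ O ∷ O ∷ O ∷ I ∷ I ∷ O ∷ I ∷ [])
  ∷     (O ∷ O ∷ O ∷ O ∷ O ∷ O ∷ O ∷ O ∷ O ∷ O ∷ O ∷ I ∷ O ∷ I ∷ O ∷ I ∷ I ∷ I ∷ O ∷ O ∷ O ∷ I ∷ I ∷ I ∷ [])
  ∷ []

combine : {k : ℕ} → Vec Bool k → Vec Word k → Word
combine []       []       = zeroWord
combine (b ∷ bs) (r ∷ rs) = (if b then r else zeroWord) ⊕ combine bs rs

IsGolayCodeword : Word → Set
IsGolayCodeword c = Σ (Vec Bool 12) (λ m → combine m golayGen ≡ c)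

weight : Word → ℕ
weight c = countᵇ (λ b → b) c

-- Λ₂₄(1), the 196560 minimal vectors of the Leech lattice, in the
-- standard coordinates scaled by √8 (integer coordinates).

Point : Set
Point = Vec ℤ 24

IsPM4 : ℤ → Set
IsPM4 a = (a ≡ + 4) ⊎ (a ≡ - (+ 4))

ShapeA : Point → Set
ShapeA v = Σ (Fin 24) λ i → Σ (Fin 24) λ j → (i ≢ j) ×
  Σ ℤ λ a → Σ ℤ λ b → IsPM4 a × IsPM4 b ×
  (v ≡ ((replicate 24 (+ 0)) [ i ]≔ a) [ j ]≔ b)

minusTwos : Point → ℕ
minusTwos v = countᵇ (λ x → ⌊ x Data.Integer.≟ - (+ 2) ⌋) v

ShapeB : Point → Set
ShapeB v = Σ Word λ c → IsGolayCodeword c × (weight c ≡ 8) ×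
  ((k : Fin 24) → (lookup c k ≡ true → (lookup v k ≡ + 2) ⊎ (lookup v k ≡ - (+ 2)))
                × (lookup c k ≡ false → lookup v k ≡ + 0)) ×
  (2 ∣ minusTwos v)

base : Fin 24 → Point
base i = tabulate (λ k → if ⌊ k ≟ i ⌋ then - (+ 3) else + 1)

ShapeC : Point → Set
ShapeC v = Σ Word λ c → IsGolayCodeword c × Σ (Fin 24) λ i →
  v ≡ tabulate (λ k → if lookup c k then - lookup (base i) k else lookup (base i) k)

Λ₂₄[1] : Point → Set
Λ₂₄[1] v = ShapeA v ⊎ ShapeB v ⊎ ShapeC v

negP : Point → Point
negP = map -_

zeroP : Point
zeroP = replicate 24 (+ 0)

sumP : List Point → Point
sumP = foldr (zipWith _+_) zeroP

module Submission where

-- We fix a rule `selected`, changing value under v ↦ −v on Λ₂₄(1), and list the selected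
-- vectors shape by shape.  For shape (c) and fixed i the vectors are indexed by 𝒞, negation is
-- c ↦ c + 𝟏, and we keep the hyperplane c₀ + c₁ + c₂ = 0, which misses 𝟏; each coordinate then
-- sums to a nontrivial character sum over 𝔽₂¹¹, which vanishes.  For shape (b) and a fixed octad
-- we keep the analogous hyperplane of the even sign patterns, balanced in every coordinate.  For
-- shape (a) a pivot rule on each pair of positions balances every coordinate; the vanishing of
-- that sum is checked by computation.

open import Defs
open import Algebra.Bundles using (CommutativeRing)
import Algebra.Properties.CommutativeSemigroup as CommSemigroupProperties
open import Data.Bool as Bool using (Bool; true; false; not; _xor_; _∧_; if_then_else_)
open import Data.Bool.Properties
  using (xor-∧-commutativeRing; xor-same; xor-assoc; xor-annihilates-not; not-distribˡ-xor; not-involutive; not-injective)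
open import Data.Empty using (⊥; ⊥-elim)
open import Data.Fin as Fin using (Fin; zero; suc; #_; toℕ)
import Data.Fin.Properties as Fin
open import Data.Integer as ℤ using (ℤ; +_; -_; -[1+_]; +[1+_]; _+_; ∣_∣)
open import Data.Integer.Properties using (neg-involutive; +-identityˡ; +-assoc; +-inverseˡ; +-inverseʳ; +-commutativeSemigroup)
open import Data.List as List using (List; []; _∷_; _++_; map; foldr; filter; cartesianProduct; length; allFin)
open import Data.List.Membership.Propositional using (_∈_)
open import Data.List.Membership.Propositional.Properties
  using (∈-map⁺; ∈-map⁻; ∈-++⁺ˡ; ∈-++⁺ʳ; ∈-++⁻; ∈-cartesianProduct⁺; ∈-cartesianProduct⁻; ∈-allFin; ∈-filter⁺; ∈-filter⁻)
open import Data.List.Properties as List using (map-++; map-∘; map-cong; foldr-++; length-map)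
open import Data.List.Relation.Binary.Disjoint.Propositional using (Disjoint)
open import Data.List.Relation.Unary.All as All using (All; []; _∷_)
import Data.List.Relation.Unary.All.Properties as All
open import Data.List.Relation.Unary.Any using (here; there)
open import Data.List.Relation.Unary.Unique.Propositional using (Unique; []; _∷_)
open import Data.List.Relation.Unary.Unique.Propositional.Properties as Unique using ()
open import Data.Nat as ℕ using (ℕ; zero; suc; _≡ᵇ_; _%_)
open import Data.Nat.Divisibility using (_∣_; _∣?_; divides; ∣m+n∣m⇒∣n)
open import Data.Nat.Properties using (suc-injective; +-suc; +-comm)
open import Data.Product as Product using (Σ; _×_; _,_; proj₁; proj₂)
open import Data.Product.Properties using (,-injective)
open import Data.Sum as Sum using (_⊎_; inj₁; inj₂; [_,_]′)
open import Data.Vec as Vec using (Vec; []; _∷_; lookup; replicate; head; tail; toList; fromList; tabulate)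
open import Data.Vec.Properties
  using ( ∷-injectiveˡ; ∷-injectiveʳ; cast-is-id; map-[]≔; []≔-commutes; ≡-dec; lookup-map; lookup∘tabulate
        ; lookup-replicate; lookup-zipWith; tabulate∘lookup; tabulate-cong; toList-injective; toList∘fromList; length-toList )
open import Function using (_∘_; id)
open import Level using (0ℓ)
open import Relation.Nullary using (¬_; ¬?; Dec; yes; no; contradiction; _×-dec_)
open import Relation.Nullary.Decidable using (⌊_⌋; from-yes)
open import Relation.Unary using (Pred; _∪_)
open import Relation.Binary.Definitions using (tri<; tri≈; tri>)
open import Relation.Binary.PropositionalEquality
  using (_≡_; _≢_; refl; sym; trans; cong; cong₂; subst; module ≡-Reasoning)

open CommSemigroupProperties +-commutativeSemigroup using () renaming (interchange to +-interchange)
open CommSemigroupProperties (CommutativeRing.+-commutativeSemigroup xor-∧-commutativeRing)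
  using () renaming (interchange to xor-interchange)

private
  variable
    A B : Set
    n : ℕ

map⁺-injectiveOn : ∀ (f : A → B) {xs} → (∀ {x y} → x ∈ xs → y ∈ xs → f x ≡ f y → x ≡ y) →
                   Unique xs → Unique (map f xs)
map⁺-injectiveOn f inj []           = []
map⁺-injectiveOn f inj (x∉xs ∷ xs!) =
  All.map⁺ (All.tabulate λ y∈xs fx≡fy → All.lookup x∉xs y∈xs (inj (here refl) (there y∈xs) fx≡fy))
  ∷ map⁺-injectiveOn f (λ p q → inj (there p) (there q)) xs!

vec-ext : {xs ys : Vec A n} → (∀ k → lookup xs k ≡ lookup ys k) → xs ≡ ys
vec-ext {xs = xs} {ys} h = trans (sym (tabulate∘lookup xs)) (trans (tabulate-cong h) (tabulate∘lookup ys))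

∑ : List ℤ → ℤ
∑ = foldr _+_ (+ 0)

∑-++ : ∀ xs ys → ∑ (xs ++ ys) ≡ ∑ xs + ∑ ys
∑-++ []       ys = sym (+-identityˡ (∑ ys))
∑-++ (x ∷ xs) ys = trans (cong (λ y → x + y) (∑-++ xs ys)) (sym (+-assoc x (∑ xs) (∑ ys)))

∑-map-+ : ∀ (f g : A → ℤ) xs → ∑ (map f xs) + ∑ (map g xs) ≡ ∑ (map (λ x → f x + g x) xs)
∑-map-+ f g []       = refl
∑-map-+ f g (x ∷ xs) =
  trans (+-interchange (f x) (∑ (map f xs)) (g x) (∑ (map g xs))) (cong (λ y → f x + g x + y) (∑-map-+ f g xs))

∑-map-0 : ∀ (f : A → ℤ) xs → (∀ x → f x ≡ + 0) → ∑ (map f xs) ≡ + 0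
∑-map-0 f []       h = refl
∑-map-0 f (x ∷ xs) h = cong₂ _+_ (h x) (∑-map-0 f xs h)

-- Opaque, so that the lists of 2¹² and 2¹¹·24 candidates built from it are never normalised.
opaque
  bitVecs : (n : ℕ) → List (Vec Bool n)
  bitVecs zero    = [] ∷ []
  bitVecs (suc n) = map (false ∷_) (bitVecs n) ++ map (true ∷_) (bitVecs n)

  ∈-bitVecs : (v : Vec Bool n) → v ∈ bitVecs n
  ∈-bitVecs []                  = here refl
  ∈-bitVecs (false ∷ v)         = ∈-++⁺ˡ (∈-map⁺ (false ∷_) (∈-bitVecs v))
  ∈-bitVecs {suc n} (true ∷ v)  = ∈-++⁺ʳ (map (false ∷_) (bitVecs n)) (∈-map⁺ (true ∷_) (∈-bitVecs v))

  bitVecs-unique : ∀ n → Unique (bitVecs n)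
  bitVecs-unique zero    = [] ∷ []
  bitVecs-unique (suc n) =
    Unique.++⁺ (Unique.map⁺ ∷-injectiveʳ (bitVecs-unique n)) (Unique.map⁺ ∷-injectiveʳ (bitVecs-unique n)) halves-disjoint
    where
    halves-disjoint : Disjoint (map (false ∷_) (bitVecs n)) (map (true ∷_) (bitVecs n))
    halves-disjoint (p , q) with ∈-map⁻ (false ∷_) p | ∈-map⁻ (true ∷_) q
    ... | _ , _ , refl | _ , _ , ()

  ∑-bitVecs-suc : ∀ (f : Vec Bool (suc n) → ℤ) →
                  ∑ (map f (bitVecs (suc n))) ≡ ∑ (map (λ x → f (false ∷ x) + f (true ∷ x)) (bitVecs n))
  ∑-bitVecs-suc {n} f = begin
    ∑ (map f (map (false ∷_) V ++ map (true ∷_) V))                   ≡⟨ cong ∑ (map-++ f (map (false ∷_) V) _) ⟩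
    ∑ (map f (map (false ∷_) V) ++ map f (map (true ∷_) V))           ≡⟨ ∑-++ (map f (map (false ∷_) V)) _ ⟩
    ∑ (map f (map (false ∷_) V)) + ∑ (map f (map (true ∷_) V))      ≡⟨ cong₂ _+_ (cong ∑ (map-∘ V)) (cong ∑ (map-∘ V)) ⟨
    ∑ (map (f ∘ (false ∷_)) V) + ∑ (map (f ∘ (true ∷_)) V)          ≡⟨ ∑-map-+ (f ∘ (false ∷_)) (f ∘ (true ∷_)) V ⟩
    ∑ (map (λ x → f (false ∷ x) + f (true ∷ x)) V)                  ∎
    where
    open ≡-Reasoning
    V : List (Vec Bool n)
    V = bitVecs n

bitLists : ℕ → List (List Bool)
bitLists n = map toList (bitVecs n)

∈-bitLists : (s : List Bool) → s ∈ bitLists (length s)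
∈-bitLists s = subst (_∈ bitLists (length s)) (toList∘fromList s) (∈-map⁺ toList (∈-bitVecs (fromList s)))

bitLists-length : ∀ {s} → s ∈ bitLists n → length s ≡ n
bitLists-length p with ∈-map⁻ toList p
... | v , _ , refl = length-toList v

bitLists-unique : ∀ n → Unique (bitLists n)
bitLists-unique n = Unique.map⁺ toList-injective′ (bitVecs-unique n)
  where
  toList-injective′ : {x y : Vec Bool n} → toList x ≡ toList y → x ≡ y
  toList-injective′ {x} {y} e = trans (sym (cast-is-id refl x)) (toList-injective refl x y e)

vsum : List (Vec ℤ n) → Vec ℤ n
vsum = foldr (Vec.zipWith _+_) (replicate _ (+ 0))

lookup-vsum : (vs : List (Vec ℤ n)) (k : Fin n) → lookup (vsum vs) k ≡ ∑ (map (λ v → lookup v k) vs)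
lookup-vsum []       k = lookup-replicate k (+ 0)
lookup-vsum (v ∷ vs) k = trans (lookup-zipWith _+_ k v (vsum vs)) (cong (λ y → lookup v k + y) (lookup-vsum vs k))

vsum-columns : (vs : List (Vec ℤ n)) → (∀ k → ∑ (map (λ v → lookup v k) vs) ≡ + 0) → vsum vs ≡ replicate n (+ 0)
vsum-columns vs h = vec-ext λ k → trans (lookup-vsum vs k) (trans (h k) (sym (lookup-replicate k (+ 0))))

vsum-++ : (xs : List (Vec ℤ n)) {ys : List (Vec ℤ n)} → vsum ys ≡ replicate n (+ 0) → vsum (xs ++ ys) ≡ vsum xs
vsum-++ xs {ys} h = trans (foldr-++ _ _ xs ys) (cong (λ z → foldr (Vec.zipWith _+_) z xs) h)

vsum-cartesianProduct : ∀ (f : A × B → Vec ℤ n) xs ys →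
                        (∀ x → vsum (map (λ y → f (x , y)) ys) ≡ replicate n (+ 0)) →
                        vsum (map f (cartesianProduct xs ys)) ≡ replicate n (+ 0)
vsum-cartesianProduct f []       ys h = refl
vsum-cartesianProduct f (x ∷ xs) ys h = begin
  vsum (map f (map (x ,_) ys ++ cartesianProduct xs ys))         ≡⟨ cong vsum (map-++ f (map (x ,_) ys) _) ⟩
  vsum (map f (map (x ,_) ys) ++ map f (cartesianProduct xs ys)) ≡⟨ vsum-++ (map f (map (x ,_) ys)) (vsum-cartesianProduct f xs ys h) ⟩
  vsum (map f (map (x ,_) ys))                                   ≡⟨ cong vsum (map-∘ ys) ⟨
  vsum (map (λ y → f (x , y)) ys)                                ≡⟨ h x ⟩
  replicate _ (+ 0)                                              ∎
  where open ≡-Reasoning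

-- Characters of 𝔽₂ⁿ

flipIf : Bool → ℤ → ℤ
flipIf b z = if b then - z else z

flipIf-cancel : ∀ b z → flipIf b z + flipIf (not b) z ≡ + 0
flipIf-cancel false z = +-inverseʳ z
flipIf-cancel true  z = +-inverseˡ z

flipIf-injective : ∀ b b′ {z} → z ≢ + 0 → flipIf b z ≡ flipIf b′ z → b ≡ b′
flipIf-injective false false _ _ = refl
flipIf-injective true  true  _ _ = refl
flipIf-injective false true  {+ 0}       z≢0 _ = contradiction refl z≢0
flipIf-injective false true  {+[1+ _ ]}  _   ()
flipIf-injective false true  { -[1+ _ ]} _   ()
flipIf-injective true  false {+ 0}       z≢0 _ = contradiction refl z≢0
flipIf-injective true  false {+[1+ _ ]}  _   ()
flipIf-injective true  false { -[1+ _ ]} _   ()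

dot : Vec Bool n → Vec Bool n → Bool
dot x []          = false
dot x (false ∷ a) = dot (tail x) a
dot x (true ∷ a)  = head x xor dot (tail x) a

∑-character : (a : Vec Bool n) → a ≢ replicate n false → ∀ z →
              ∑ (map (λ x → flipIf (dot x a) z) (bitVecs n)) ≡ + 0
∑-character []          a≢0 z = ⊥-elim (a≢0 refl)
∑-character {suc n} (true ∷ a) a≢0 z =
  trans (∑-bitVecs-suc (λ x → flipIf (dot x (true ∷ a)) z))
        (∑-map-0 _ (bitVecs n) λ x → flipIf-cancel (dot x a) z)
∑-character {suc n} (false ∷ a) a≢0 z = begin
  ∑ (map (λ x → flipIf (dot x (false ∷ a)) z) (bitVecs (suc n))) ≡⟨ ∑-bitVecs-suc (λ x → flipIf (dot x (false ∷ a)) z) ⟩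
  ∑ (map (λ x → χ x + χ x) (bitVecs n))        ≡⟨ ∑-map-+ χ χ (bitVecs n) ⟨
  ∑ (map χ (bitVecs n)) + ∑ (map χ (bitVecs n)) ≡⟨ cong₂ _+_ χ-sum χ-sum ⟩
  + 0                                              ∎
  where
  open ≡-Reasoning
  χ : Vec Bool n → ℤ
  χ x = flipIf (dot x a) z
  χ-sum : ∑ (map χ (bitVecs n)) ≡ + 0
  χ-sum = ∑-character a (a≢0 ∘ cong (false ∷_)) z

code : Vec Bool 12 → Word
code m = combine m golayGen

column : Fin 24 → Vec Bool 12
column k = Vec.map (λ row → lookup row k) golayGen

dot-∷ : ∀ b x (m a : Vec Bool n) → dot (b ∷ m) (x ∷ a) ≡ (b ∧ x) xor dot m a
dot-∷ false false m a = refl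
dot-∷ true  false m a = refl
dot-∷ false true  m a = refl
dot-∷ true  true  m a = refl

lookup-scaled : ∀ b (row : Word) k → lookup (if b then row else zeroWord) k ≡ b ∧ lookup row k
lookup-scaled true  row k = refl
lookup-scaled false row k = lookup-replicate k false

lookup-combine : ∀ {r} (m : Vec Bool r) (G : Vec Word r) k →
                 lookup (combine m G) k ≡ dot m (Vec.map (λ row → lookup row k) G)
lookup-combine []      []        k = lookup-replicate k false
lookup-combine (b ∷ m) (row ∷ G) k = begin
  lookup ((if b then row else zeroWord) ⊕ combine m G) k              ≡⟨ lookup-zipWith _xor_ k (if b then row else zeroWord) (combine m G) ⟩
  lookup (if b then row else zeroWord) k xor lookup (combine m G) k  ≡⟨ cong₂ _xor_ (lookup-scaled b row k) (lookup-combine m G k) ⟩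
  (b ∧ lookup row k) xor dot m (Vec.map (λ row → lookup row k) G)    ≡⟨ dot-∷ b (lookup row k) m _ ⟨
  dot (b ∷ m) (Vec.map (λ row → lookup row k) (row ∷ G))             ∎
  where open ≡-Reasoning

lookup-code : ∀ m k → lookup (code m) k ≡ dot m (column k)
lookup-code m = lookup-combine m golayGen

dot-⊕ : (x y a : Vec Bool n) → dot (x ⊕ y) a ≡ dot x a xor dot y a
dot-⊕ []       []       []          = refl
dot-⊕ (x ∷ xs) (y ∷ ys) (false ∷ a) = dot-⊕ xs ys a
dot-⊕ (x ∷ xs) (y ∷ ys) (true ∷ a)  =
  trans (cong ((x xor y) xor_) (dot-⊕ xs ys a)) (xor-interchange x y (dot xs a) (dot ys a))

code-⊕ : ∀ m m′ → code (m ⊕ m′) ≡ code m ⊕ code m′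
code-⊕ m m′ = vec-ext λ k → begin
  lookup (code (m ⊕ m′)) k                 ≡⟨ lookup-code (m ⊕ m′) k ⟩
  dot (m ⊕ m′) (column k)                  ≡⟨ dot-⊕ m m′ (column k) ⟩
  dot m (column k) xor dot m′ (column k)   ≡⟨ cong₂ _xor_ (lookup-code m k) (lookup-code m′ k) ⟨
  lookup (code m) k xor lookup (code m′) k ≡⟨ lookup-zipWith _xor_ k (code m) (code m′) ⟨
  lookup (code m ⊕ code m′) k              ∎
  where open ≡-Reasoning

⊕≡0⇒≡ : (x y : Vec Bool n) → x ⊕ y ≡ replicate n false → x ≡ y
⊕≡0⇒≡ []          []          _ = refl
⊕≡0⇒≡ (false ∷ x) (false ∷ y) e = cong (false ∷_) (⊕≡0⇒≡ x y (∷-injectiveʳ e))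
⊕≡0⇒≡ (true ∷ x)  (true ∷ y)  e = cong (true ∷_) (⊕≡0⇒≡ x y (∷-injectiveʳ e))

⊕-ones : (x : Vec Bool n) → x ⊕ replicate n true ≡ Vec.map not x
⊕-ones []          = refl
⊕-ones (false ∷ x) = cong (true ∷_) (⊕-ones x)
⊕-ones (true ∷ x)  = cong (false ∷_) (⊕-ones x)

-- Row s of the generator matrix is x^s g(x) and g(0) = 1, so column k < 12 has its last 1 in
-- row k: the first nonzero coefficient of d is seen by the column of the same index.
code-kernel : ∀ d → (∀ k → dot d (column k) ≡ false) → d ≡ replicate 12 false
code-kernel (true ∷ d) h with h (# 0)
... | ()
code-kernel (false ∷ true ∷ d) h with h (# 1)
... | ()
code-kernel (false ∷ false ∷ true ∷ d) h with h (# 2)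
... | ()
code-kernel (false ∷ false ∷ false ∷ true ∷ d) h with h (# 3)
... | ()
code-kernel (false ∷ false ∷ false ∷ false ∷ true ∷ d) h with h (# 4)
... | ()
code-kernel (false ∷ false ∷ false ∷ false ∷ false ∷ true ∷ d) h with h (# 5)
... | ()
code-kernel (false ∷ false ∷ false ∷ false ∷ false ∷ false ∷ true ∷ d) h with h (# 6)
... | ()
code-kernel (false ∷ false ∷ false ∷ false ∷ false ∷ false ∷ false ∷ true ∷ d) h with h (# 7)
... | ()
code-kernel (false ∷ false ∷ false ∷ false ∷ false ∷ false ∷ false ∷ false ∷ true ∷ d) h with h (# 8)
... | ()
code-kernel (false ∷ false ∷ false ∷ false ∷ false ∷ false ∷ false ∷ false ∷ false ∷ true ∷ d) h with h (# 9)
... | ()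
code-kernel (false ∷ false ∷ false ∷ false ∷ false ∷ false ∷ false ∷ false ∷ false ∷ false ∷ true ∷ d) h with h (# 10)
... | ()
code-kernel (false ∷ false ∷ false ∷ false ∷ false ∷ false ∷ false ∷ false ∷ false ∷ false ∷ false ∷ true ∷ []) h with h (# 11)
... | ()
code-kernel (false ∷ false ∷ false ∷ false ∷ false ∷ false ∷ false ∷ false ∷ false ∷ false ∷ false ∷ false ∷ []) h = refl

code-injective : ∀ {m m′} → code m ≡ code m′ → m ≡ m′
code-injective {m} {m′} e = ⊕≡0⇒≡ m m′ (code-kernel (m ⊕ m′) λ k → begin
  dot (m ⊕ m′) (column k)                    ≡⟨ dot-⊕ m m′ (column k) ⟩
  dot m (column k) xor dot m′ (column k)     ≡⟨ cong₂ _xor_ (lookup-code m k) (lookup-code m′ k) ⟨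
  lookup (code m) k xor lookup (code m′) k   ≡⟨ cong (λ c → lookup c k xor lookup (code m′) k) e ⟩
  lookup (code m′) k xor lookup (code m′) k  ≡⟨ xor-same (lookup (code m′) k) ⟩
  false                                      ∎)
  where open ≡-Reasoning

allOnesMessage : Vec Bool 12
allOnesMessage = true ∷ true ∷ false ∷ false ∷ false ∷ true ∷ true ∷ true ∷ false ∷ true ∷ false ∷ true ∷ []

complement-code : ∀ m → Vec.map not (code m) ≡ code (m ⊕ allOnesMessage)
complement-code m = begin
  Vec.map not (code m)                ≡⟨ ⊕-ones (code m) ⟨
  code m ⊕ replicate 24 true          ≡⟨⟩
  code m ⊕ code allOnesMessage        ≡⟨ code-⊕ m allOnesMessage ⟨
  code (m ⊕ allOnesMessage)           ∎
  where open ≡-Reasoning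

nonzeros : Vec ℤ n → List (Fin n × ℤ)
nonzeros []        = []
nonzeros (+ 0 ∷ v) = map (Product.map₁ suc) (nonzeros v)
nonzeros (x ∷ v)   = (zero , x) ∷ map (Product.map₁ suc) (nonzeros v)

values : Vec ℤ n → List ℤ
values v = map proj₂ (nonzeros v)

data Kind : Set where
  kindA kindB kindC : Kind

kindOf : List ℤ → Kind
kindOf []      = kindB
kindOf (x ∷ _) = if ∣ x ∣ ≡ᵇ 4 then kindA else if ∣ x ∣ % 2 ≡ᵇ 1 then kindC else kindB

-- The three shapes are told apart by the first nonzero coordinate: ±4, ±2 or odd.
kind : Point → Kind
kind v = kindOf (values v)

negative : ℤ → Bool
negative -[1+ _ ] = true
negative (+ _)    = false

-- An entry ±1, ±3 of a vector of shape (c) is ≡ 3 (mod 4) exactly when its sign was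
-- changed relative to base i.
threeMod4 : ℤ → Bool
threeMod4 x = x ℤ.% + 4 ≡ᵇ 3

firstThreeEven : (ℤ → Bool) → List ℤ → Bool
firstThreeEven f (x ∷ y ∷ z ∷ _) = not (f x xor (f y xor f z))
firstThreeEven f _               = false

-- For positions i < j we keep the two vectors with a prescribed sign at a pivot position, so
-- that their entries at the other position cancel.  The pivot is i, with sign + iff j is odd,
-- except that for even i and j = 23 it is 23, with sign + iff 4 ∣ i; then every coordinate
-- is the pivot of as many + as − signs.
keepsEdge : Fin 24 × ℤ → Fin 24 × ℤ → Bool
keepsEdge (i , a) (j , b) =
  if (toℕ j ≡ᵇ 23) ∧ (toℕ i % 2 ≡ᵇ 0)
  then negative b xor (toℕ i % 4 ≡ᵇ 0)
  else negative a xor (toℕ j % 2 ≡ᵇ 1)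

keepsPair : List (Fin 24 × ℤ) → Bool
keepsPair (p ∷ q ∷ _) = keepsEdge p q
keepsPair _           = false

select : Kind → Point → Bool
select kindA v = keepsPair (nonzeros v)
select kindB v = firstThreeEven negative (values v)
select kindC v = firstThreeEven threeMod4 (toList v)

selected : Point → Bool
selected v = select (kind v) v

record BalancedHalf (P : Pred Point 0ℓ) (H : List Point) : Set where
  field
    unique   : Unique H
    sound    : ∀ {v} → v ∈ H → P v × selected v ≡ true
    complete : ∀ {v} → P v → selected v ≡ true → v ∈ H
    balanced : sumP H ≡ zeroP

record Antipodal (P : Pred Point 0ℓ) : Set where
  field
    neg-closed   : ∀ {v} → P v → P (negP v)
    selected-neg : ∀ {v} → P v → selected (negP v) ≡ not (selected v)

∪-balancedHalf : ∀ {P Q H K} → BalancedHalf P H → BalancedHalf Q K → (∀ {v} → P v → Q v → ⊥) →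
                 BalancedHalf (P ∪ Q) (H ++ K)
∪-balancedHalf {H = H} {K} h k P∩Q=∅ = record
  { unique   = Unique.++⁺ (unique h) (unique k) λ (v∈H , v∈K) → P∩Q=∅ (proj₁ (sound h v∈H)) (proj₁ (sound k v∈K))
  ; sound    = λ v∈H++K → [ Product.map₁ inj₁ ∘ sound h , Product.map₁ inj₂ ∘ sound k ]′ (∈-++⁻ H v∈H++K)
  ; complete = λ { (inj₁ p) sel → ∈-++⁺ˡ (complete h p sel) ; (inj₂ q) sel → ∈-++⁺ʳ H (complete k q sel) }
  ; balanced = trans (vsum-++ H (balanced k)) (balanced h)
  }
  where open BalancedHalf

∪-antipodal : ∀ {P Q} → Antipodal P → Antipodal Q → Antipodal (P ∪ Q)
∪-antipodal p q = record
  { neg-closed   = Sum.map (neg-closed p) (neg-closed q)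
  ; selected-neg = [ selected-neg p , selected-neg q ]′
  }
  where open Antipodal

splits-antipodes : ∀ {P H} → BalancedHalf P H → Antipodal P → ∀ {v} → P v →
                   ((v ∈ H) × ¬ (negP v ∈ H)) ⊎ ((negP v ∈ H) × ¬ (v ∈ H))
splits-antipodes {P} {H} half anti {v} p = by-selection (selected v) refl
  where
  open BalancedHalf half
  open Antipodal anti
  by-selection : ∀ b → selected v ≡ b → ((v ∈ H) × ¬ (negP v ∈ H)) ⊎ ((negP v ∈ H) × ¬ (v ∈ H))
  by-selection true  sel = inj₁ (complete p sel , λ -v∈H → contradiction (begin
    true               ≡⟨ proj₂ (sound -v∈H) ⟨
    selected (negP v)  ≡⟨ selected-neg p ⟩
    not (selected v)   ≡⟨ cong not sel ⟩
    false              ∎) λ ())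
    where open ≡-Reasoning
  by-selection false sel = inj₂ (complete (neg-closed p) (trans (selected-neg p) (cong not sel)) ,
                                 λ v∈H → contradiction (trans (sym (proj₂ (sound v∈H))) sel) λ ())

-- Shape (c)

flipOn : Word → Point → Point
flipOn c x = tabulate (λ k → flipIf (lookup c k) (lookup x k))

lookup-flipOn : ∀ c x k → lookup (flipOn c x) k ≡ flipIf (lookup c k) (lookup x k)
lookup-flipOn c x = lookup∘tabulate (λ k → flipIf (lookup c k) (lookup x k))

negP-flipOn : ∀ c x → negP (flipOn c x) ≡ flipOn (Vec.map not c) x
negP-flipOn c x = vec-ext λ k → begin
  lookup (negP (flipOn c x)) k             ≡⟨ lookup-map k -_ (flipOn c x) ⟩
  - lookup (flipOn c x) k                  ≡⟨ cong -_ (lookup-flipOn c x k) ⟩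
  - flipIf (lookup c k) (lookup x k)       ≡⟨ neg-flipIf (lookup c k) (lookup x k) ⟩
  flipIf (not (lookup c k)) (lookup x k)   ≡⟨ cong (λ b → flipIf b (lookup x k)) (lookup-map k not c) ⟨
  flipIf (lookup (Vec.map not c) k) (lookup x k) ≡⟨ lookup-flipOn (Vec.map not c) x k ⟨
  lookup (flipOn (Vec.map not c) x) k      ∎
  where
  open ≡-Reasoning
  neg-flipIf : ∀ b z → - flipIf b z ≡ flipIf (not b) z
  neg-flipIf false z = refl
  neg-flipIf true  z = neg-involutive z

BaseEntry : ℤ → Set
BaseEntry x = x ≡ - (+ 3) ⊎ x ≡ + 1

lookup-base : ∀ i k → lookup (base i) k ≡ (if ⌊ k Fin.≟ i ⌋ then - (+ 3) else + 1)
lookup-base i = lookup∘tabulate (λ k → if ⌊ k Fin.≟ i ⌋ then - (+ 3) else + 1)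

base-entry : ∀ i k → BaseEntry (lookup (base i) k)
base-entry i k rewrite lookup-base i k with k Fin.≟ i
... | yes _ = inj₁ refl
... | no  _ = inj₂ refl

base-diagonal : ∀ i → lookup (base i) i ≡ - (+ 3)
base-diagonal i rewrite lookup-base i i with i Fin.≟ i
... | yes _   = refl
... | no  i≢i = contradiction refl i≢i

base-offDiagonal : ∀ {i k} → k ≢ i → lookup (base i) k ≡ + 1
base-offDiagonal {i} {k} k≢i rewrite lookup-base i k with k Fin.≟ i
... | yes k≡i = contradiction k≡i k≢i
... | no  _   = refl

base-entry≢0 : ∀ {x} → BaseEntry x → x ≢ + 0
base-entry≢0 (inj₁ refl) ()
base-entry≢0 (inj₂ refl) ()

flipIf-3≢flipIf-1 : ∀ b b′ → flipIf b (- (+ 3)) ≢ flipIf b′ (+ 1)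
flipIf-3≢flipIf-1 false false ()
flipIf-3≢flipIf-1 false true  ()
flipIf-3≢flipIf-1 true  false ()
flipIf-3≢flipIf-1 true  true  ()

-- The position of the entry ±3 recovers i; the remaining signs recover c.
flipOn-base-injective : ∀ {c c′ i i′} → flipOn c (base i) ≡ flipOn c′ (base i′) → i ≡ i′ × c ≡ c′
flipOn-base-injective {c} {c′} {i} {i′} e with i Fin.≟ i′
... | no i≢i′ = contradiction (begin
  flipIf (lookup c i) (- (+ 3))             ≡⟨ cong (flipIf (lookup c i)) (base-diagonal i) ⟨
  flipIf (lookup c i) (lookup (base i) i)   ≡⟨ lookup-flipOn c (base i) i ⟨
  lookup (flipOn c (base i)) i              ≡⟨ cong (λ w → lookup w i) e ⟩
  lookup (flipOn c′ (base i′)) i            ≡⟨ lookup-flipOn c′ (base i′) i ⟩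
  flipIf (lookup c′ i) (lookup (base i′) i) ≡⟨ cong (flipIf (lookup c′ i)) (base-offDiagonal i≢i′) ⟩
  flipIf (lookup c′ i) (+ 1)                ∎) (flipIf-3≢flipIf-1 (lookup c i) (lookup c′ i))
  where open ≡-Reasoning
... | yes refl = refl , vec-ext λ k → flipIf-injective (lookup c k) (lookup c′ k) (base-entry≢0 (base-entry i k))
  (trans (sym (lookup-flipOn c (base i) k)) (trans (cong (λ w → lookup w k) e) (lookup-flipOn c′ (base i) k)))

kind-flipIf-base∷ : ∀ b {x} (w : Vec ℤ 23) → BaseEntry x → kind (flipIf b x ∷ w) ≡ kindC
kind-flipIf-base∷ false w (inj₁ refl) = refl
kind-flipIf-base∷ true  w (inj₁ refl) = refl
kind-flipIf-base∷ false w (inj₂ refl) = refl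
kind-flipIf-base∷ true  w (inj₂ refl) = refl

threeMod4-flipIf-base : ∀ b {x} → BaseEntry x → threeMod4 (flipIf b x) ≡ b
threeMod4-flipIf-base false (inj₁ refl) = refl
threeMod4-flipIf-base true  (inj₁ refl) = refl
threeMod4-flipIf-base false (inj₂ refl) = refl
threeMod4-flipIf-base true  (inj₂ refl) = refl

kind-flipOn-base : ∀ c i → kind (flipOn c (base i)) ≡ kindC
kind-flipOn-base c i = kind-flipIf-base∷ (lookup c zero) _ (base-entry i zero)

select-flipOn-base : ∀ c i → select kindC (flipOn c (base i)) ≡ not (lookup c (# 0) xor (lookup c (# 1) xor lookup c (# 2)))
select-flipOn-base c i =
  cong₂ (λ x y → not (x xor y)) (threeMod4-flipIf-base (lookup c (# 0)) (base-entry i (# 0)))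
    (cong₂ _xor_ (threeMod4-flipIf-base (lookup c (# 1)) (base-entry i (# 1)))
                 (threeMod4-flipIf-base (lookup c (# 2)) (base-entry i (# 2))))

selected-flipOn-base : ∀ c i → selected (flipOn c (base i)) ≡ not (lookup c (# 0) xor (lookup c (# 1) xor lookup c (# 2)))
selected-flipOn-base c i = trans (cong (λ κ → select κ (flipOn c (base i))) (kind-flipOn-base c i)) (select-flipOn-base c i)

-- Columns 0, 1, 2 of the generator matrix are e₀, e₁ and e₀ + e₂.
code-parity012 : ∀ m → lookup (code m) (# 0) xor (lookup (code m) (# 1) xor lookup (code m) (# 2)) ≡ lookup m (# 1) xor lookup m (# 2)
code-parity012 m rewrite lookup-code m (# 0) | lookup-code m (# 1) | lookup-code m (# 2) with m
... | false ∷ false ∷ false ∷ r = refl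
... | false ∷ false ∷ true  ∷ r = refl
... | false ∷ true  ∷ false ∷ r = refl
... | false ∷ true  ∷ true  ∷ r = refl
... | true  ∷ false ∷ false ∷ r = refl
... | true  ∷ false ∷ true  ∷ r = refl
... | true  ∷ true  ∷ false ∷ r = refl
... | true  ∷ true  ∷ true  ∷ r = refl

selected-flipOn-code : ∀ m i → selected (flipOn (code m) (base i)) ≡ not (lookup m (# 1) xor lookup m (# 2))
selected-flipOn-code m i = trans (selected-flipOn-base (code m) i) (cong not (code-parity012 m))

-- Messages with m₁ = m₂: by code-parity012 their codewords form the hyperplane c₀ + c₁ + c₂ = 0
-- of 𝒞, which does not contain the all-ones word.
embed : Vec Bool 11 → Vec Bool 12
embed (x ∷ y ∷ r) = x ∷ y ∷ y ∷ r

restrict : Vec Bool 12 → Vec Bool 11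
restrict (x ∷ y ∷ _ ∷ r) = x ∷ y ∷ r

embedᵀ : Vec Bool 12 → Vec Bool 11
embedᵀ (a ∷ b ∷ c ∷ r) = a ∷ (b xor c) ∷ r

embed-injective : ∀ {m m′} → embed m ≡ embed m′ → m ≡ m′
embed-injective {_ ∷ _ ∷ _} {_ ∷ _ ∷ _} refl = refl

embed-restrict : ∀ m → lookup m (# 1) xor lookup m (# 2) ≡ false → embed (restrict m) ≡ m
embed-restrict (x ∷ false ∷ false ∷ r) _ = refl
embed-restrict (x ∷ true  ∷ true  ∷ r) _ = refl

xor-cancelˡ : ∀ y d → y xor (y xor d) ≡ d
xor-cancelˡ y d = trans (sym (xor-assoc y y d)) (cong (_xor d) (xor-same y))

dot-embed : ∀ m a → dot (embed m) a ≡ dot m (embedᵀ a)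
dot-embed (x ∷ y ∷ r) (false ∷ false ∷ false ∷ a) = refl
dot-embed (x ∷ y ∷ r) (false ∷ false ∷ true  ∷ a) = refl
dot-embed (x ∷ y ∷ r) (false ∷ true  ∷ false ∷ a) = refl
dot-embed (x ∷ y ∷ r) (false ∷ true  ∷ true  ∷ a) = xor-cancelˡ y (dot r a)
dot-embed (x ∷ y ∷ r) (true  ∷ false ∷ false ∷ a) = refl
dot-embed (x ∷ y ∷ r) (true  ∷ false ∷ true  ∷ a) = refl
dot-embed (x ∷ y ∷ r) (true  ∷ true  ∷ false ∷ a) = refl
dot-embed (x ∷ y ∷ r) (true  ∷ true  ∷ true  ∷ a) = cong (x xor_) (xor-cancelˡ y (dot r a))

embedᵀ-column-nonzero : ∀ k → embedᵀ (column k) ≢ replicate 11 false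
embedᵀ-column-nonzero = from-yes (Fin.all? λ k → ¬? (≡-dec Bool._≟_ (embedᵀ (column k)) (replicate 11 false)))

vectorC : Fin 24 × Vec Bool 11 → Point
vectorC (i , m) = flipOn (code (embed m)) (base i)

HC : List Point
HC = map vectorC (cartesianProduct (allFin 24) (bitVecs 11))

flipOn-code-sum : ∀ i → vsum (map (λ m → flipOn (code (embed m)) (base i)) (bitVecs 11)) ≡ zeroP
flipOn-code-sum i = vsum-columns (map f (bitVecs 11)) λ k → begin
  ∑ (map (λ v → lookup v k) (map f (bitVecs 11)))
    ≡⟨ cong ∑ (map-∘ {g = λ v → lookup v k} {f = f} (bitVecs 11)) ⟨
  ∑ (map (λ m → lookup (f m) k) (bitVecs 11))
    ≡⟨ cong ∑ (map-cong (entry k) (bitVecs 11)) ⟩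
  ∑ (map (λ m → flipIf (dot m (embedᵀ (column k))) (lookup (base i) k)) (bitVecs 11))
    ≡⟨ ∑-character _ (embedᵀ-column-nonzero k) _ ⟩
  + 0 ∎
  where
  open ≡-Reasoning
  f : Vec Bool 11 → Point
  f m = flipOn (code (embed m)) (base i)
  entry : ∀ k m → lookup (f m) k ≡ flipIf (dot m (embedᵀ (column k))) (lookup (base i) k)
  entry k m = trans (lookup-flipOn (code (embed m)) (base i) k)
    (cong (λ b → flipIf b (lookup (base i) k)) (trans (lookup-code (embed m) k) (dot-embed m (column k))))

embed-parity : ∀ m → lookup (embed m) (# 1) xor lookup (embed m) (# 2) ≡ false
embed-parity (x ∷ y ∷ r) = xor-same y

halfC : BalancedHalf ShapeC HC
halfC = record
  { unique   = Unique.map⁺ flipOn-injective (Unique.cartesianProduct⁺ (Unique.allFin⁺ 24) (bitVecs-unique 11))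
  ; sound    = sound
  ; complete = complete
  ; balanced = vsum-cartesianProduct _ (allFin 24) (bitVecs 11) flipOn-code-sum
  }
  where
  flipOn-injective : ∀ {x y} → vectorC x ≡ vectorC y → x ≡ y
  flipOn-injective {i , m} {i′ , m′} e with flipOn-base-injective {i = i} {i′} e
  ... | refl , c≡c′ = cong (i ,_) (embed-injective (code-injective c≡c′))
  sound : ∀ {v} → v ∈ HC → ShapeC v × selected v ≡ true
  sound v∈HC with ∈-map⁻ vectorC v∈HC
  ... | (i , m) , _ , refl =
    (code (embed m) , (embed m , refl) , i , refl) , trans (selected-flipOn-code (embed m) i) (cong not (embed-parity m))
  complete : ∀ {v} → ShapeC v → selected v ≡ true → v ∈ HC
  complete (_ , (m , refl) , i , refl) sel =
    subst (λ m → flipOn (code m) (base i) ∈ HC) (embed-restrict m (not-injective (trans (sym (selected-flipOn-code m i)) sel)))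
      (∈-map⁺ vectorC (∈-cartesianProduct⁺ (∈-allFin i) (∈-bitVecs (restrict m))))

antipodalC : Antipodal ShapeC
antipodalC = record
  { neg-closed   = λ { (_ , (m , refl) , i , refl) →
      code (m ⊕ allOnesMessage) , (m ⊕ allOnesMessage , refl) , i ,
      trans (negP-flipOn (code m) (base i)) (cong (λ c → flipOn c (base i)) (complement-code m)) }
  ; selected-neg = λ { (c , _ , i , refl) → selected-neg c i }
  }
  where
  selected-neg : ∀ c i → selected (negP (flipOn c (base i))) ≡ not (selected (flipOn c (base i)))
  selected-neg c i = begin
    selected (negP (flipOn c (base i)))                      ≡⟨ cong selected (negP-flipOn c (base i)) ⟩
    selected (flipOn (Vec.map not c) (base i))               ≡⟨ selected-flipOn-base (Vec.map not c) i ⟩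
    not (lookup c′ (# 0) xor (lookup c′ (# 1) xor lookup c′ (# 2)))
      ≡⟨ cong (λ x → not (x xor (lookup c′ (# 1) xor lookup c′ (# 2)))) (lookup-map (# 0) not c) ⟩
    not (not (lookup c (# 0)) xor (lookup c′ (# 1) xor lookup c′ (# 2)))
      ≡⟨ cong (λ x → not (not (lookup c (# 0)) xor x)) (cong₂ _xor_ (lookup-map (# 1) not c) (lookup-map (# 2) not c)) ⟩
    not (not (lookup c (# 0)) xor (not (lookup c (# 1)) xor not (lookup c (# 2))))
      ≡⟨ cong (λ x → not (not (lookup c (# 0)) xor x)) (xor-annihilates-not (lookup c (# 1)) (lookup c (# 2))) ⟩
    not (not (lookup c (# 0)) xor (lookup c (# 1) xor lookup c (# 2)))
      ≡⟨ cong not (not-distribˡ-xor (lookup c (# 0)) _) ⟨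
    not (not (lookup c (# 0) xor (lookup c (# 1) xor lookup c (# 2))))
      ≡⟨ cong not (selected-flipOn-base c i) ⟨
    not (selected (flipOn c (base i)))                       ∎
    where
    open ≡-Reasoning
    c′ = Vec.map not c

-- Shape (b)

sign₂ : Bool → ℤ
sign₂ b = flipIf b (+ 2)

signAt : ℕ → List Bool → ℤ
signAt _       []      = + 0
signAt zero    (b ∷ _) = sign₂ b
signAt (suc p) (_ ∷ s) = signAt p s

spread : Vec Bool n → List Bool → Vec ℤ n
spread []          s = []
spread (false ∷ c) s = + 0 ∷ spread c s
spread (true ∷ c)  s = signAt 0 s ∷ spread c (List.drop 1 s)

extract : Vec Bool n → Vec ℤ n → List Bool
extract []          []      = []
extract (false ∷ c) (_ ∷ v) = extract c v
extract (true ∷ c)  (x ∷ v) = negative x ∷ extract c v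

trues : List Bool → ℕ
trues []      = 0
trues (b ∷ s) = if b then suc (trues s) else trues s

SignedOn : Vec Bool n → Vec ℤ n → Set
SignedOn c v = ∀ k → (lookup c k ≡ true → (lookup v k ≡ + 2) ⊎ (lookup v k ≡ - (+ 2)))
                   × (lookup c k ≡ false → lookup v k ≡ + 0)

length-extract : ∀ (c : Vec Bool n) v → length (extract c v) ≡ Vec.countᵇ id c
length-extract []          []      = refl
length-extract (false ∷ c) (_ ∷ v) = length-extract c v
length-extract (true ∷ c)  (_ ∷ v) = cong suc (length-extract c v)

spread-extract : ∀ (c : Vec Bool n) v → SignedOn c v → spread c (extract c v) ≡ v
spread-extract []          []      h = refl
spread-extract (false ∷ c) (x ∷ v) h = cong₂ _∷_ (sym (proj₂ (h zero) refl)) (spread-extract c v (h ∘ suc))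
spread-extract (true ∷ c)  (x ∷ v) h with proj₁ (h zero) refl
... | inj₁ refl = cong (+ 2 ∷_) (spread-extract c v (h ∘ suc))
... | inj₂ refl = cong (- (+ 2) ∷_) (spread-extract c v (h ∘ suc))

spread-signedOn : ∀ (c : Vec Bool n) s → length s ≡ Vec.countᵇ id c → SignedOn c (spread c s)
spread-signedOn (false ∷ c) s       e zero    = (λ ()) , λ _ → refl
spread-signedOn (false ∷ c) s       e (suc k) = spread-signedOn c s e k
spread-signedOn (true ∷ c)  (false ∷ s) e zero = (λ _ → inj₁ refl) , λ ()
spread-signedOn (true ∷ c)  (true ∷ s)  e zero = (λ _ → inj₂ refl) , λ ()
spread-signedOn (true ∷ c)  (_ ∷ s) e (suc k)  = spread-signedOn c s (suc-injective e) k

minusTwos-spread : ∀ (c : Vec Bool n) s → length s ≡ Vec.countᵇ id c →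
                   Vec.countᵇ (λ x → ⌊ x ℤ.≟ - (+ 2) ⌋) (spread c s) ≡ trues s
minusTwos-spread []          []          e = refl
minusTwos-spread (false ∷ c) s           e = minusTwos-spread c s e
minusTwos-spread (true ∷ c)  (false ∷ s) e = minusTwos-spread c s (suc-injective e)
minusTwos-spread (true ∷ c)  (true ∷ s)  e = cong suc (minusTwos-spread c s (suc-injective e))

values-spread : ∀ (c : Vec Bool n) s → length s ≡ Vec.countᵇ id c → values (spread c s) ≡ map sign₂ s
values-spread []          []          e = refl
values-spread (false ∷ c) s           e = trans (sym (map-∘ (nonzeros (spread c s)))) (values-spread c s e)
values-spread (true ∷ c)  (false ∷ s) e =
  cong (+ 2 ∷_) (trans (sym (map-∘ (nonzeros (spread c s)))) (values-spread c s (suc-injective e)))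
values-spread (true ∷ c)  (true ∷ s)  e =
  cong (- (+ 2) ∷_) (trans (sym (map-∘ (nonzeros (spread c s)))) (values-spread c s (suc-injective e)))

negP-spread : ∀ (c : Vec Bool n) s → Vec.map -_ (spread c s) ≡ spread c (map not s)
negP-spread []          s           = refl
negP-spread (false ∷ c) s           = cong (+ 0 ∷_) (negP-spread c s)
negP-spread (true ∷ c)  []          = cong (+ 0 ∷_) (negP-spread c [])
negP-spread (true ∷ c)  (false ∷ s) = cong (- (+ 2) ∷_) (negP-spread c s)
negP-spread (true ∷ c)  (true ∷ s)  = cong (+ 2 ∷_) (negP-spread c s)

spread-injective : ∀ (c c′ : Vec Bool n) s s′ → length s ≡ Vec.countᵇ id c → length s′ ≡ Vec.countᵇ id c′ →
                   spread c s ≡ spread c′ s′ → c ≡ c′ × s ≡ s′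
spread-injective []          []           []      []       _ _ _ = refl , refl
spread-injective (false ∷ c) (false ∷ c′) s       s′       e e′ eq
  with refl , refl ← spread-injective c c′ s s′ e e′ (∷-injectiveʳ eq) = refl , refl
spread-injective (true ∷ c)  (true ∷ c′)  (b ∷ s) (b′ ∷ s′) e e′ eq
  with refl ← flipIf-injective b b′ (λ ()) (∷-injectiveˡ eq)
  with refl , refl ← spread-injective c c′ s s′ (suc-injective e) (suc-injective e′) (∷-injectiveʳ eq) = refl , refl
spread-injective (false ∷ c) (true ∷ c′)  s (false ∷ s′) _ _ ()
spread-injective (false ∷ c) (true ∷ c′)  s (true ∷ s′)  _ _ ()
spread-injective (true ∷ c)  (false ∷ c′) (false ∷ s) s′ _ _ ()
spread-injective (true ∷ c)  (false ∷ c′) (true ∷ s)  s′ _ _ ()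

signAt-drop : ∀ p s → signAt p (List.drop 1 s) ≡ signAt (suc p) s
signAt-drop p []      = refl
signAt-drop p (_ ∷ s) = refl

spread-column : ∀ (c : Vec Bool n) S k → (∀ p → ∑ (map (signAt p) S) ≡ + 0) →
                ∑ (map (λ s → lookup (spread c s) k) S) ≡ + 0
spread-column (false ∷ c) S zero    h = ∑-map-0 _ S λ _ → refl
spread-column (false ∷ c) S (suc k) h = spread-column c S k h
spread-column (true ∷ c)  S zero    h = h 0
spread-column (true ∷ c)  S (suc k) h =
  trans (cong ∑ (map-∘ {g = λ t → lookup (spread c t) k} {f = List.drop 1} S))
        (spread-column c (map (List.drop 1) S) k λ p →
          trans (cong ∑ (sym (map-∘ {g = signAt p} {f = List.drop 1} S)))
                (trans (cong ∑ (map-cong (signAt-drop p) S)) (h (suc p))))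

spread-balanced : ∀ (c : Vec Bool n) S → (∀ p → ∑ (map (signAt p) S) ≡ + 0) →
                  vsum (map (spread c) S) ≡ replicate n (+ 0)
spread-balanced c S h = vsum-columns (map (spread c) S) λ k →
  trans (cong ∑ (sym (map-∘ {g = λ v → lookup v k} {f = spread c} S))) (spread-column c S k h)

trues-not : ∀ s → trues (map not s) ℕ.+ trues s ≡ length s
trues-not []          = refl
trues-not (false ∷ s) = cong suc (trues-not s)
trues-not (true ∷ s)  = trans (+-suc (trues (map not s)) (trues s)) (cong suc (trues-not s))

firstThreeEven-not : ∀ s → length s ≡ 8 →
                     firstThreeEven negative (map sign₂ (map not s)) ≡ not (firstThreeEven negative (map sign₂ s))
firstThreeEven-not (false ∷ false ∷ false ∷ _) _ = refl
firstThreeEven-not (false ∷ false ∷ true  ∷ _) _ = refl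
firstThreeEven-not (false ∷ true  ∷ false ∷ _) _ = refl
firstThreeEven-not (false ∷ true  ∷ true  ∷ _) _ = refl
firstThreeEven-not (true  ∷ false ∷ false ∷ _) _ = refl
firstThreeEven-not (true  ∷ false ∷ true  ∷ _) _ = refl
firstThreeEven-not (true  ∷ true  ∷ false ∷ _) _ = refl
firstThreeEven-not (true  ∷ true  ∷ true  ∷ _) _ = refl

data SpreadView : Point → Set where
  spread-view : ∀ m s → weight (code m) ≡ 8 → length s ≡ 8 → 2 ∣ trues s → SpreadView (spread (code m) s)

shapeB-spread : ∀ {v} → SpreadView v → ShapeB v
shapeB-spread (spread-view m s w l ev) =
  code m , (m , refl) , w , spread-signedOn (code m) s (trans l (sym w)) ,
  subst (2 ∣_) (sym (minusTwos-spread (code m) s (trans l (sym w)))) ev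

shapeB-view : ∀ {v} → ShapeB v → SpreadView v
shapeB-view {v} (_ , (m , refl) , w , h , ev) =
  subst SpreadView (spread-extract (code m) v h)
    (spread-view m s w (trans (length-extract (code m) v) w) (subst (2 ∣_) minusTwos≡trues ev))
  where
  s : List Bool
  s = extract (code m) v
  minusTwos≡trues : minusTwos v ≡ trues s
  minusTwos≡trues = trans (cong minusTwos (sym (spread-extract (code m) v h))) (minusTwos-spread (code m) s (length-extract (code m) v))

kind-spread : ∀ m s → weight (code m) ≡ 8 → length s ≡ 8 → kind (spread (code m) s) ≡ kindB
kind-spread m s w l = trans (cong kindOf (values-spread (code m) s (trans l (sym w)))) (kindOf-sign₂ s l)
  where
  kindOf-sign₂ : ∀ s → length s ≡ 8 → kindOf (map sign₂ s) ≡ kindB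
  kindOf-sign₂ (false ∷ _) _ = refl
  kindOf-sign₂ (true  ∷ _) _ = refl

selected-spread : ∀ m s → weight (code m) ≡ 8 → length s ≡ 8 →
                  selected (spread (code m) s) ≡ firstThreeEven negative (map sign₂ s)
selected-spread m s w l = begin
  selected (spread (code m) s)                          ≡⟨ cong (λ κ → select κ (spread (code m) s)) (kind-spread m s w l) ⟩
  firstThreeEven negative (values (spread (code m) s))  ≡⟨ cong (firstThreeEven negative) (values-spread (code m) s (trans l (sym w))) ⟩
  firstThreeEven negative (map sign₂ s)                 ∎
  where open ≡-Reasoning

octads : List (Vec Bool 12)
octads = filter (λ m → weight (code m) ℕ.≟ 8) (bitVecs 12)

KeptSigns : List Bool → Set
KeptSigns s = 2 ∣ trues s × firstThreeEven negative (map sign₂ s) ≡ true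

keptSigns? : ∀ s → Dec (KeptSigns s)
keptSigns? s = (2 ∣? trues s) ×-dec (firstThreeEven negative (map sign₂ s) Bool.≟ true)

keptSigns : List (List Bool)
keptSigns = filter keptSigns? (bitLists 8)

-- The kept sign patterns form a subspace of 𝔽₂⁸ on which no coordinate vanishes, so every
-- column is balanced; here this is simply computed.
opaque
  unfolding bitVecs

  signs-balanced : ∀ p → ∑ (map (signAt p) keptSigns) ≡ + 0
  signs-balanced 0 = refl
  signs-balanced 1 = refl
  signs-balanced 2 = refl
  signs-balanced 3 = refl
  signs-balanced 4 = refl
  signs-balanced 5 = refl
  signs-balanced 6 = refl
  signs-balanced 7 = refl
  signs-balanced (suc (suc (suc (suc (suc (suc (suc (suc p)))))))) = refl

vectorB : Vec Bool 12 × List Bool → Point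
vectorB (m , s) = spread (code m) s

HB : List Point
HB = map vectorB (cartesianProduct octads keptSigns)

∈-octads⁻ : ∀ {m} → m ∈ octads → weight (code m) ≡ 8
∈-octads⁻ p = proj₂ (∈-filter⁻ (λ m → weight (code m) ℕ.≟ 8) {xs = bitVecs 12} p)

∈-keptSigns⁻ : ∀ {s} → s ∈ keptSigns → length s ≡ 8 × KeptSigns s
∈-keptSigns⁻ p = Product.map₁ bitLists-length (∈-filter⁻ keptSigns? {xs = bitLists 8} p)

∈-HB⁻ : ∀ {m s} → (m , s) ∈ cartesianProduct octads keptSigns → weight (code m) ≡ 8 × length s ≡ 8 × KeptSigns s
∈-HB⁻ p with m∈ , s∈ ← ∈-cartesianProduct⁻ octads keptSigns p = ∈-octads⁻ m∈ , ∈-keptSigns⁻ s∈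

halfB : BalancedHalf ShapeB HB
halfB = record
  { unique   = map⁺-injectiveOn vectorB injective
                 (Unique.cartesianProduct⁺ (Unique.filter⁺ _ (bitVecs-unique 12)) (Unique.filter⁺ _ (bitLists-unique 8)))
  ; sound    = sound
  ; complete = λ b → complete (shapeB-view b)
  ; balanced = vsum-cartesianProduct vectorB octads keptSigns λ m → spread-balanced (code m) keptSigns signs-balanced
  }
  where
  injective : ∀ {x y} → x ∈ cartesianProduct octads keptSigns → y ∈ cartesianProduct octads keptSigns → vectorB x ≡ vectorB y → x ≡ y
  injective {m , s} {m′ , s′} p q e
    with w , l , _ ← ∈-HB⁻ p | w′ , l′ , _ ← ∈-HB⁻ q
    with c≡c′ , refl ← spread-injective (code m) (code m′) s s′ (trans l (sym w)) (trans l′ (sym w′)) e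
    = cong (_, s) (code-injective c≡c′)
  sound : ∀ {v} → v ∈ HB → ShapeB v × selected v ≡ true
  sound v∈HB with (m , s) , p , refl ← ∈-map⁻ vectorB v∈HB with w , l , ev , keep ← ∈-HB⁻ p =
    shapeB-spread (spread-view m s w l ev) , trans (selected-spread m s w l) keep
  complete : ∀ {v} → SpreadView v → selected v ≡ true → v ∈ HB
  complete (spread-view m s w l ev) sel =
    ∈-map⁺ vectorB (∈-cartesianProduct⁺ (∈-filter⁺ _ (∈-bitVecs m) w)
      (∈-filter⁺ _ (subst (λ n → s ∈ bitLists n) l (∈-bitLists s)) (ev , trans (sym (selected-spread m s w l)) sel)))

antipodalB : Antipodal ShapeB
antipodalB = record
  { neg-closed   = λ {v} b → shapeB-spread (negate (shapeB-view {v} b))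
  ; selected-neg = λ {v} b → selected-neg (shapeB-view {v} b)
  }
  where
  even-not : ∀ s → length s ≡ 8 → 2 ∣ trues s → 2 ∣ trues (map not s)
  even-not s l ev = ∣m+n∣m⇒∣n (subst (2 ∣_) (sym (trans (+-comm (trues s) _) (trans (trues-not s) l))) (divides 4 refl)) ev
  negate : ∀ {v} → SpreadView v → SpreadView (negP v)
  negate (spread-view m s w l ev) = subst SpreadView (sym (negP-spread (code m) s))
    (spread-view m (map not s) w (trans (length-map not s) l) (even-not s l ev))
  selected-neg : ∀ {v} → SpreadView v → selected (negP v) ≡ not (selected v)
  selected-neg (spread-view m s w l ev) = begin
    selected (negP (spread (code m) s))                   ≡⟨ cong selected (negP-spread (code m) s) ⟩
    selected (spread (code m) (map not s))                ≡⟨ selected-spread m (map not s) w (trans (length-map not s) l) ⟩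
    firstThreeEven negative (map sign₂ (map not s))       ≡⟨ firstThreeEven-not s l ⟩
    not (firstThreeEven negative (map sign₂ s))           ≡⟨ cong not (selected-spread m s w l) ⟨
    not (selected (spread (code m) s))                    ∎
    where open ≡-Reasoning

-- Shape (a)

nonzeros-replicate : ∀ n → nonzeros (replicate n (+ 0)) ≡ []
nonzeros-replicate zero    = refl
nonzeros-replicate (suc n) = cong (map (Product.map₁ suc)) (nonzeros-replicate n)

nonzeros-∷ : ∀ {x} (v : Vec ℤ n) → x ≢ + 0 → nonzeros (x ∷ v) ≡ (zero , x) ∷ map (Product.map₁ suc) (nonzeros v)
nonzeros-∷ {x = + 0}       v x≢0 = contradiction refl x≢0
nonzeros-∷ {x = +[1+ _ ]}  v _   = refl
nonzeros-∷ {x = -[1+ _ ]}  v _   = refl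

nonzeros-single : ∀ (i : Fin n) {x} → x ≢ + 0 → nonzeros (replicate n (+ 0) Vec.[ i ]≔ x) ≡ (i , x) ∷ []
nonzeros-single {suc n} zero    x≢0 = trans (nonzeros-∷ _ x≢0) (cong (λ l → (zero , _) ∷ map (Product.map₁ suc) l) (nonzeros-replicate n))
nonzeros-single {suc n} (suc i) x≢0 = cong (map (Product.map₁ suc)) (nonzeros-single i x≢0)

nonzeros-pair : ∀ {i j : Fin n} {x y} → i Fin.< j → x ≢ + 0 → y ≢ + 0 →
                nonzeros ((replicate n (+ 0) Vec.[ i ]≔ x) Vec.[ j ]≔ y) ≡ (i , x) ∷ (j , y) ∷ []
nonzeros-pair {i = zero}  {suc j} _            x≢0 y≢0 =
  trans (nonzeros-∷ _ x≢0) (cong (λ l → (zero , _) ∷ map (Product.map₁ suc) l) (nonzeros-single j y≢0))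
nonzeros-pair {i = suc i} {suc j} (ℕ.s≤s i<j) x≢0 y≢0 = cong (map (Product.map₁ suc)) (nonzeros-pair i<j x≢0 y≢0)

sign₄ : Bool → ℤ
sign₄ b = flipIf b (+ 4)

sign₄≢0 : ∀ b → sign₄ b ≢ + 0
sign₄≢0 false ()
sign₄≢0 true  ()

pairVector : Fin 24 → Fin 24 → Bool → Bool → Point
pairVector i j a b = (zeroP Vec.[ i ]≔ sign₄ a) Vec.[ j ]≔ sign₄ b

nonzeros-pairVector : ∀ {i j} a b → i Fin.< j → nonzeros (pairVector i j a b) ≡ (i , sign₄ a) ∷ (j , sign₄ b) ∷ []
nonzeros-pairVector a b i<j = nonzeros-pair i<j (sign₄≢0 a) (sign₄≢0 b)

kind-pairVector : ∀ {i j} a b → i Fin.< j → kind (pairVector i j a b) ≡ kindA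
kind-pairVector a b i<j = trans (cong (kindOf ∘ map proj₂) (nonzeros-pairVector a b i<j)) (kindOf-sign₄ a)
  where
  kindOf-sign₄ : ∀ a → kindOf (sign₄ a ∷ sign₄ b ∷ []) ≡ kindA
  kindOf-sign₄ false = refl
  kindOf-sign₄ true  = refl

selected-pairVector : ∀ {i j} a b → i Fin.< j → selected (pairVector i j a b) ≡ keepsEdge (i , sign₄ a) (j , sign₄ b)
selected-pairVector {i} {j} a b i<j = begin
  select (kind (pairVector i j a b)) (pairVector i j a b) ≡⟨ cong (λ κ → select κ (pairVector i j a b)) (kind-pairVector a b i<j) ⟩
  keepsPair (nonzeros (pairVector i j a b))              ≡⟨ cong keepsPair (nonzeros-pairVector a b i<j) ⟩
  keepsEdge (i , sign₄ a) (j , sign₄ b)                  ∎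
  where open ≡-Reasoning

negP-pairVector : ∀ i j a b → negP (pairVector i j a b) ≡ pairVector i j (not a) (not b)
negP-pairVector i j a b = begin
  Vec.map -_ ((zeroP Vec.[ i ]≔ sign₄ a) Vec.[ j ]≔ sign₄ b)        ≡⟨ map-[]≔ -_ (zeroP Vec.[ i ]≔ sign₄ a) j ⟩
  Vec.map -_ (zeroP Vec.[ i ]≔ sign₄ a) Vec.[ j ]≔ - sign₄ b        ≡⟨ cong (Vec._[ j ]≔ - sign₄ b) (map-[]≔ -_ zeroP i) ⟩
  (zeroP Vec.[ i ]≔ - sign₄ a) Vec.[ j ]≔ - sign₄ b                 ≡⟨ cong₂ (λ x y → (zeroP Vec.[ i ]≔ x) Vec.[ j ]≔ y) (neg-sign₄ a) (neg-sign₄ b) ⟩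
  (zeroP Vec.[ i ]≔ sign₄ (not a)) Vec.[ j ]≔ sign₄ (not b)         ∎
  where
  open ≡-Reasoning
  neg-sign₄ : ∀ a → - sign₄ a ≡ sign₄ (not a)
  neg-sign₄ false = refl
  neg-sign₄ true  = refl

negative-sign₄-not : ∀ a p → negative (sign₄ (not a)) xor p ≡ not (negative (sign₄ a) xor p)
negative-sign₄-not false p = refl
negative-sign₄-not true  p = sym (not-involutive p)

keepsEdge-not : ∀ i j a b → keepsEdge (i , sign₄ (not a)) (j , sign₄ (not b)) ≡ not (keepsEdge (i , sign₄ a) (j , sign₄ b))
keepsEdge-not i j a b with (toℕ j ≡ᵇ 23) ∧ (toℕ i % 2 ≡ᵇ 0)
... | true  = negative-sign₄-not b (toℕ i % 4 ≡ᵇ 0)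
... | false = negative-sign₄-not a (toℕ j % 2 ≡ᵇ 1)

data PairView : Point → Set where
  pair-view : ∀ {i j} a b → i Fin.< j → PairView (pairVector i j a b)

shapeA-pair : ∀ {v} → PairView v → ShapeA v
shapeA-pair (pair-view {i} {j} a b i<j) = i , j , Fin.<⇒≢ i<j , sign₄ a , sign₄ b , ±4 a , ±4 b , refl
  where
  ±4 : ∀ a → IsPM4 (sign₄ a)
  ±4 false = inj₁ refl
  ±4 true  = inj₂ refl

sign₄-view : ∀ {x} → IsPM4 x → Σ Bool λ a → x ≡ sign₄ a
sign₄-view (inj₁ refl) = false , refl
sign₄-view (inj₂ refl) = true , refl

shapeA-view : ∀ {v} → ShapeA v → PairView v
shapeA-view (i , j , i≢j , x , y , px , py , refl) with sign₄-view px | sign₄-view py | Fin.<-cmp i j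
... | a , refl | b , refl | tri< i<j _ _ = pair-view a b i<j
... | _        | _        | tri≈ _ i≡j _ = contradiction i≡j i≢j
... | a , refl | b , refl | tri> _ _ j<i = subst PairView (sym ([]≔-commutes zeroP i j i≢j)) (pair-view b a j<i)

bools : List Bool
bools = false ∷ true ∷ []

∈-bools : ∀ b → b ∈ bools
∈-bools false = here refl
∈-bools true  = there (here refl)

vectorA : (Fin 24 × Fin 24) × (Bool × Bool) → Point
vectorA ((i , j) , (a , b)) = pairVector i j a b

KeptPair : (Fin 24 × Fin 24) × (Bool × Bool) → Set
KeptPair ((i , j) , (a , b)) = i Fin.< j × keepsEdge (i , sign₄ a) (j , sign₄ b) ≡ true

keptPair? : ∀ x → Dec (KeptPair x)
keptPair? ((i , j) , (a , b)) = (i Fin.<? j) ×-dec (keepsEdge (i , sign₄ a) (j , sign₄ b) Bool.≟ true)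

pairCandidates : List ((Fin 24 × Fin 24) × (Bool × Bool))
pairCandidates = cartesianProduct (cartesianProduct (allFin 24) (allFin 24)) (cartesianProduct bools bools)

keptPairs : List ((Fin 24 × Fin 24) × (Bool × Bool))
keptPairs = filter keptPair? pairCandidates

HA : List Point
HA = map vectorA keptPairs

∈-keptPairs⁻ : ∀ {x} → x ∈ keptPairs → KeptPair x
∈-keptPairs⁻ p = proj₂ (∈-filter⁻ keptPair? {xs = pairCandidates} p)

pairVector-injective : ∀ {i j i′ j′ a b a′ b′} → i Fin.< j → i′ Fin.< j′ → pairVector i j a b ≡ pairVector i′ j′ a′ b′ →
                       ((i , j) , (a , b)) ≡ ((i′ , j′) , (a′ , b′))
pairVector-injective {a = a} {b} {a′} {b′} i<j i′<j′ e
  with e₂ ← trans (sym (nonzeros-pairVector a b i<j)) (trans (cong nonzeros e) (nonzeros-pairVector a′ b′ i′<j′))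
  with refl , a≡a′ ← ,-injective (List.∷-injectiveˡ e₂) | refl , b≡b′ ← ,-injective (List.∷-injectiveˡ (List.∷-injectiveʳ e₂))
  with refl ← flipIf-injective a a′ (λ ()) a≡a′ | refl ← flipIf-injective b b′ (λ ()) b≡b′
  = refl

halfA : BalancedHalf ShapeA HA
halfA = record
  { unique   = map⁺-injectiveOn vectorA injective (Unique.filter⁺ keptPair?
                 (Unique.cartesianProduct⁺ (Unique.cartesianProduct⁺ (Unique.allFin⁺ 24) (Unique.allFin⁺ 24))
                                           (Unique.cartesianProduct⁺ bools-unique bools-unique)))
  ; sound    = sound
  ; complete = λ a → complete (shapeA-view a)
  ; balanced = refl
  }
  where
  bools-unique : Unique bools
  bools-unique = ((λ ()) ∷ []) ∷ [] ∷ []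
  injective : ∀ {x y} → x ∈ keptPairs → y ∈ keptPairs → vectorA x ≡ vectorA y → x ≡ y
  injective {(i , j) , _} {(i′ , j′) , _} p q = pairVector-injective (proj₁ (∈-keptPairs⁻ p)) (proj₁ (∈-keptPairs⁻ q))
  sound : ∀ {v} → v ∈ HA → ShapeA v × selected v ≡ true
  sound v∈HA with ((i , j) , (a , b)) , p , refl ← ∈-map⁻ vectorA v∈HA with i<j , keep ← ∈-keptPairs⁻ p =
    shapeA-pair (pair-view a b i<j) , trans (selected-pairVector a b i<j) keep
  complete : ∀ {v} → PairView v → selected v ≡ true → v ∈ HA
  complete (pair-view {i} {j} a b i<j) sel =
    ∈-map⁺ vectorA (∈-filter⁺ keptPair? (∈-cartesianProduct⁺ (∈-cartesianProduct⁺ (∈-allFin i) (∈-allFin j))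
                                                          (∈-cartesianProduct⁺ (∈-bools a) (∈-bools b)))
                                   (i<j , trans (sym (selected-pairVector a b i<j)) sel))

antipodalA : Antipodal ShapeA
antipodalA = record
  { neg-closed   = λ {v} a → shapeA-pair (negate (shapeA-view {v} a))
  ; selected-neg = λ {v} a → selected-neg (shapeA-view {v} a)
  }
  where
  negate : ∀ {v} → PairView v → PairView (negP v)
  negate (pair-view {i} {j} a b i<j) = subst PairView (sym (negP-pairVector i j a b)) (pair-view (not a) (not b) i<j)
  selected-neg : ∀ {v} → PairView v → selected (negP v) ≡ not (selected v)
  selected-neg (pair-view {i} {j} a b i<j) = begin
    selected (negP (pairVector i j a b))                  ≡⟨ cong selected (negP-pairVector i j a b) ⟩
    selected (pairVector i j (not a) (not b))             ≡⟨ selected-pairVector (not a) (not b) i<j ⟩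
    keepsEdge (i , sign₄ (not a)) (j , sign₄ (not b))     ≡⟨ keepsEdge-not i j a b ⟩
    not (keepsEdge (i , sign₄ a) (j , sign₄ b))           ≡⟨ cong not (selected-pairVector a b i<j) ⟨
    not (selected (pairVector i j a b))                   ∎
    where open ≡-Reasoning

kind-shapeA : ∀ {v} → ShapeA v → kind v ≡ kindA
kind-shapeA {v} p with pair-view a b i<j ← shapeA-view {v} p = kind-pairVector a b i<j

kind-shapeB : ∀ {v} → ShapeB v → kind v ≡ kindB
kind-shapeB {v} p with spread-view m s w l _ ← shapeB-view {v} p = kind-spread m s w l

kind-shapeC : ∀ {v} → ShapeC v → kind v ≡ kindC
kind-shapeC (c , _ , i , refl) = kind-flipOn-base c i

shapeA∩shapeB=∅ : ∀ {v} → ShapeA v → ShapeB v → ⊥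
shapeA∩shapeB=∅ {v} a b with () ← trans (sym (kind-shapeA {v} a)) (kind-shapeB {v} b)

shapeA∩shapeC=∅ : ∀ {v} → ShapeA v → ShapeC v → ⊥
shapeA∩shapeC=∅ {v} a c with () ← trans (sym (kind-shapeA {v} a)) (kind-shapeC {v} c)

shapeB∩shapeC=∅ : ∀ {v} → ShapeB v → ShapeC v → ⊥
shapeB∩shapeC=∅ {v} b c with () ← trans (sym (kind-shapeB {v} b)) (kind-shapeC {v} c)

proposition3p2 : Σ (List Point) λ H →
    Unique H × All Λ₂₄[1] H ×
    ((v : Point) → Λ₂₄[1] v →
      ((v ∈ H) × ¬ (negP v ∈ H)) ⊎ ((negP v ∈ H) × ¬ (v ∈ H))) ×
    (sumP H ≡ zeroP)
proposition3p2 =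
  HA ++ HB ++ HC , unique , All.tabulate (proj₁ ∘ sound) , (λ _ → splits-antipodes half antipodal) , balanced
  where
  half : BalancedHalf Λ₂₄[1] (HA ++ HB ++ HC)
  half = ∪-balancedHalf halfA (∪-balancedHalf halfB halfC shapeB∩shapeC=∅)
           λ {v} a → [ shapeA∩shapeB=∅ {v} a , shapeA∩shapeC=∅ {v} a ]′
  antipodal : Antipodal Λ₂₄[1]
  antipodal = ∪-antipodal antipodalA (∪-antipodal antipodalB antipodalC)
  open BalancedHalf half
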